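{- Let $F$ be a connected graph. Let $A$ and $B$ be vertex-disjoint graphs, and let $D_A$ and $D_B$ be minimum $F$-isolating sets of $A$ and $B$, respectively. Let $G$ be a graph with $V(G)=V(A)\cup V(B)$ and $E(G)=E(A)\cup E(B)\cup E'$, where every edge $e'\in E'$ has at least one vertex in $N_A[D_A]$ or in $N_B[D_B]$. Then $\iota(G,F)\le \iota(A,F)+\iota(B,F)$.
   Context: All graphs are finite and simple. A copy of $F$ in a graph is a subgraph isomorphic to $F$. $N_H[D]$ denotes the closed neighbourhood of the vertex set $D$ in the graph $H$. A set $D\subseteq V(H)$ is an $F$-isolating set of $H$ if $H-N_H[D]$ contains no copy of $F$; it is minimum if it has the smallest possible size, and $\iota(H,F)$ denotes this minimum size. -}

module Defs where

open import Data.Nat using (ℕ; _+_; _≤_)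
open import Data.Fin using (Fin; _↑ˡ_; _↑ʳ_)
open import Data.Fin.Subset using (Subset; _∈_; _∉_; ∣_∣)
open import Data.Product using (Σ; ∃; ∃-syntax; _×_; _,_)
open import Data.Sum using (_⊎_)
open import Data.Empty using (⊥)
open import Relation.Nullary using (¬_)
open import Relation.Binary.PropositionalEquality using (_≡_)
open import Relation.Binary.Construct.Closure.ReflexiveTransitive using (Star)
open import Function.Definitions using (Injective)

record Graph (n : ℕ) : Set₁ where
  field
    Adj   : Fin n → Fin n → Set
    sym   : ∀ {u v} → Adj u v → Adj v u
    irrefl : ∀ {v} → ¬ Adj v v
open Graph public

Connected : ∀ {k} → Graph k → Set
Connected F = ∀ u v → Star (Adj F) u v

_∈N[_]_ : ∀ {n} → Fin n → Graph n → Subset n → Set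
v ∈N[ H ] D = v ∈ D ⊎ (∃[ u ] (u ∈ D × Adj H u v))

-- a copy of F in H - N_H[D]: an injective edge-preserving map from V(F)
-- into V(H) \ N_H[D]  (i.e. a subgraph of H - N_H[D] isomorphic to F)
record CopyAvoiding {k n} (F : Graph k) (H : Graph n) (D : Subset n) : Set where
  field
    f     : Fin k → Fin n
    inj   : Injective _≡_ _≡_ f
    edges : ∀ {i j} → Adj F i j → Adj H (f i) (f j)
    avoid : ∀ i → ¬ (f i ∈N[ H ] D)

Isolating : ∀ {k n} → Graph n → Graph k → Subset n → Set
Isolating H F D = ¬ CopyAvoiding F H D

MinIsolating : ∀ {k n} → Graph n → Graph k → Subset n → Set
MinIsolating H F D = Isolating H F D × (∀ D' → Isolating H F D' → ∣ D ∣ ≤ ∣ D' ∣)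

IsIota : ∀ {k n} → Graph n → Graph k → ℕ → Set
IsIota H F m = Σ (Subset _) λ D → MinIsolating H F D × ∣ D ∣ ≡ m

-- G on V(A) ⊔ V(B) = Fin (a + b)  (A-vertices i ↑ˡ b, B-vertices a ↑ʳ j)
-- with E(G) = E(A) ∪ E(B) ∪ E', every e' ∈ E' meeting N_A[D_A] ∪ N_B[D_B].
EdgeFromA : ∀ {a b} → Graph a → Fin (a + b) → Fin (a + b) → Set
EdgeFromA {a} {b} A u v = ∃[ i ] ∃[ j ] (u ≡ i ↑ˡ b × v ≡ j ↑ˡ b × Adj A i j)

EdgeFromB : ∀ {a b} → Graph b → Fin (a + b) → Fin (a + b) → Set
EdgeFromB {a} {b} B u v = ∃[ i ] ∃[ j ] (u ≡ a ↑ʳ i × v ≡ a ↑ʳ j × Adj B i j)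

InCore : ∀ {a b} → Graph a → Subset a → Graph b → Subset b → Fin (a + b) → Set
InCore {a} {b} A DA B DB u =
  (∃[ i ] (u ≡ i ↑ˡ b × i ∈N[ A ] DA)) ⊎ (∃[ j ] (u ≡ a ↑ʳ j × j ∈N[ B ] DB))

record Glued {a b} (A : Graph a) (DA : Subset a) (B : Graph b) (DB : Subset b)
              (G : Graph (a + b)) : Set where
  field
    A⊆G : ∀ {i j} → Adj A i j → Adj G (i ↑ˡ b) (j ↑ˡ b)
    B⊆G : ∀ {i j} → Adj B i j → Adj G (a ↑ʳ i) (a ↑ʳ j)
    G⊆  : ∀ {u v} → Adj G u v →
          EdgeFromA {a} {b} A u v ⊎ EdgeFromB {a} {b} B u v
            ⊎ (InCore A DA B DB u ⊎ InCore A DA B DB v)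

{-# OPTIONS --safe #-}
-- Take D = D_A ∪ D_B.  Every edge of G − N_G[D] avoids N_A[D_A] ∪ N_B[D_B], so it is
-- not in E' and lies inside A or inside B.  A copy of the connected graph F in
-- G − N_G[D] therefore lies entirely in A − N_A[D_A] or entirely in B − N_B[D_B],
-- which is impossible.
module Submission where

open import Defs hiding (sym)
open import Data.Nat using (zero; suc; _+_; _≤_)
open import Data.Nat.Properties using (≤-reflexive; ≤-trans)
open import Data.Fin using (Fin; zero; _↑ˡ_; _↑ʳ_; splitAt)
open import Data.Fin.Properties using (↑ˡ-injective; ↑ʳ-injective; splitAt-↑ˡ; splitAt-↑ʳ; splitAt⁻¹-↑ˡ; splitAt⁻¹-↑ʳ)
open import Data.Fin.Subset using (Subset; _∈_; ∣_∣)
open import Data.Vec using (_∷_; []; _++_)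
open import Data.Vec.Properties using (lookup⇒[]=; []=⇒lookup; lookup-++ˡ; lookup-++ʳ)
open import Data.Bool using (true; false)
open import Data.Product using (∃-syntax; _×_; _,_; proj₁; proj₂)
open import Data.Sum using (_⊎_; inj₁; inj₂)
open import Data.Empty using (⊥-elim)
open import Function.Definitions using (Injective)
open import Relation.Nullary using (¬_)
open import Relation.Binary.PropositionalEquality using (_≡_; _≢_; refl; sym; trans; cong; subst)
open import Relation.Binary.Construct.Closure.ReflexiveTransitive using (Star; ε; _◅_)

∣p++q∣≡∣p∣+∣q∣ : ∀ {m n} (p : Subset m) (q : Subset n) → ∣ p ++ q ∣ ≡ ∣ p ∣ + ∣ q ∣
∣p++q∣≡∣p∣+∣q∣ []          q = refl
∣p++q∣≡∣p∣+∣q∣ (true ∷ p)  q = cong suc (∣p++q∣≡∣p∣+∣q∣ p q)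
∣p++q∣≡∣p∣+∣q∣ (false ∷ p) q = ∣p++q∣≡∣p∣+∣q∣ p q

x∈p⇒x↑ˡ∈p++q : ∀ {m n} {p : Subset m} (q : Subset n) {x} → x ∈ p → x ↑ˡ n ∈ p ++ q
x∈p⇒x↑ˡ∈p++q {p = p} q {x} x∈p = lookup⇒[]= _ (p ++ q) (trans (lookup-++ˡ p q x) ([]=⇒lookup x∈p))

x∈q⇒m↑ʳx∈p++q : ∀ {m n} (p : Subset m) {q : Subset n} {x} → x ∈ q → m ↑ʳ x ∈ p ++ q
x∈q⇒m↑ʳx∈p++q p {q} {x} x∈q = lookup⇒[]= _ (p ++ q) (trans (lookup-++ʳ p q x) ([]=⇒lookup x∈q))

↑ˡ≢↑ʳ : ∀ {m n} (i : Fin m) (j : Fin n) → i ↑ˡ n ≢ m ↑ʳ j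
↑ˡ≢↑ʳ {m} {n} i j eq with trans (sym (splitAt-↑ˡ m i n)) (trans (cong (splitAt m) eq) (splitAt-↑ʳ m n j))
... | ()

↑ˡ-or-↑ʳ : ∀ {m n} (u : Fin (m + n)) → (∃[ i ] u ≡ i ↑ˡ n) ⊎ (∃[ j ] u ≡ m ↑ʳ j)
↑ˡ-or-↑ʳ {m} u with splitAt m u in eq
... | inj₁ i = inj₁ (i , sym (splitAt⁻¹-↑ˡ eq))
... | inj₂ j = inj₂ (j , sym (splitAt⁻¹-↑ʳ eq))

empty-copy : ∀ {n} (F : Graph 0) (H : Graph n) (D : Subset n) → CopyAvoiding F H D
empty-copy F H D = record { f = λ () ; inj = λ { {()} } ; edges = λ { {()} } ; avoid = λ () }

-- The image of H is a union of components of G − N_G[DG], and N_H[DH] is sent into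
-- N_G[DG]; so a copy of a connected graph in G − N_G[DG] meeting the image pulls back
-- to a copy in H − N_H[DH].
record Embedding {m n} (H : Graph m) (DH : Subset m) (G : Graph n) (DG : Subset n) : Set where
  field
    ι             : Fin m → Fin n
    ι-injective   : Injective _≡_ _≡_ ι
    ι-preserves-N : ∀ {i} → i ∈N[ H ] DH → ι i ∈N[ G ] DG
    ι-reflects-outer-edges : ∀ {i v} → ¬ ι i ∈N[ G ] DG → ¬ v ∈N[ G ] DG →
                             Adj G (ι i) v → ∃[ j ] (v ≡ ι j × Adj H i j)

module _ {k m n} {F : Graph k} {H : Graph m} {G : Graph n} {DH : Subset m} {DG : Subset n}
         (F-connected : Connected F) (emb : Embedding H DH G DG) (c : CopyAvoiding F G DG) where
  open Embedding emb
  open CopyAvoiding c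

  edge-pullback : ∀ {x y i} → f x ≡ ι i → Adj F x y → ∃[ j ] (f y ≡ ι j × Adj H i j)
  edge-pullback {x} {y} fx≡ιi e =
    ι-reflects-outer-edges (λ ιi∈N → avoid x (subst (_∈N[ G ] DG) (sym fx≡ιi) ιi∈N)) (avoid y)
                           (subst (λ u → Adj G u (f y)) fx≡ιi (edges e))

  walk-pullback : ∀ {x y i} → Star (Adj F) x y → f x ≡ ι i → ∃[ j ] f y ≡ ι j
  walk-pullback ε       fx≡ιi = _ , fx≡ιi
  walk-pullback (e ◅ w) fx≡ιi = let (_ , fz≡ιj , _) = edge-pullback fx≡ιi e in walk-pullback w fz≡ιj

  pullback : ∀ x₀ {i₀} → f x₀ ≡ ι i₀ → CopyAvoiding F H DH
  pullback x₀ fx₀≡ιi₀ = record { f = g ; inj = g-injective ; edges = g-edges ; avoid = g-avoid }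
    where
    g : Fin k → Fin m
    g y = proj₁ (walk-pullback (F-connected x₀ y) fx₀≡ιi₀)

    f≡ι∘g : ∀ y → f y ≡ ι (g y)
    f≡ι∘g y = proj₂ (walk-pullback (F-connected x₀ y) fx₀≡ιi₀)

    g-injective : Injective _≡_ _≡_ g
    g-injective {x} {y} gx≡gy = inj (trans (f≡ι∘g x) (trans (cong ι gx≡gy) (sym (f≡ι∘g y))))

    g-edges : ∀ {x y} → Adj F x y → Adj H (g x) (g y)
    g-edges {x} {y} e =
      let (j , fy≡ιj , gx~j) = edge-pullback (f≡ι∘g x) e
      in subst (Adj H (g x)) (ι-injective (trans (sym fy≡ιj) (f≡ι∘g y))) gx~j

    g-avoid : ∀ y → ¬ (g y ∈N[ H ] DH)
    g-avoid y gy∈N = avoid y (subst (_∈N[ G ] DG) (sym (f≡ι∘g y)) (ι-preserves-N gy∈N))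

module _ {a b} {A : Graph a} {B : Graph b} {DA : Subset a} {DB : Subset b} {G : Graph (a + b)}
         (glued : Glued A DA B DB G) where
  open Glued glued

  core⊆N : ∀ {u} → InCore A DA B DB u → u ∈N[ G ] (DA ++ DB)
  core⊆N (inj₁ (i , refl , inj₁ i∈DA))            = inj₁ (x∈p⇒x↑ˡ∈p++q DB i∈DA)
  core⊆N (inj₁ (i , refl , inj₂ (u , u∈DA , u~i))) = inj₂ (u ↑ˡ b , x∈p⇒x↑ˡ∈p++q DB u∈DA , A⊆G u~i)
  core⊆N (inj₂ (j , refl , inj₁ j∈DB))            = inj₁ (x∈q⇒m↑ʳx∈p++q DA j∈DB)
  core⊆N (inj₂ (j , refl , inj₂ (u , u∈DB , u~j))) = inj₂ (a ↑ʳ u , x∈q⇒m↑ʳx∈p++q DA u∈DB , B⊆G u~j)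

  outer-edge : ∀ {u v} → ¬ u ∈N[ G ] (DA ++ DB) → ¬ v ∈N[ G ] (DA ++ DB) → Adj G u v →
               EdgeFromA {b = b} A u v ⊎ EdgeFromB {a = a} B u v
  outer-edge u∉N v∉N u~v with G⊆ u~v
  ... | inj₁ fromA                = inj₁ fromA
  ... | inj₂ (inj₁ fromB)         = inj₂ fromB
  ... | inj₂ (inj₂ (inj₁ u∈core)) = ⊥-elim (u∉N (core⊆N u∈core))
  ... | inj₂ (inj₂ (inj₂ v∈core)) = ⊥-elim (v∉N (core⊆N v∈core))

  left-embedding : Embedding A DA G (DA ++ DB)
  left-embedding = record
    { ι = _↑ˡ b
    ; ι-injective = ↑ˡ-injective b _ _
    ; ι-preserves-N = λ {i} i∈N → core⊆N (inj₁ (i , refl , i∈N))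
    ; ι-reflects-outer-edges = reflects
    }
    where
    reflects : ∀ {i v} → ¬ (i ↑ˡ b) ∈N[ G ] (DA ++ DB) → ¬ v ∈N[ G ] (DA ++ DB) →
               Adj G (i ↑ˡ b) v → ∃[ j ] (v ≡ j ↑ˡ b × Adj A i j)
    reflects {i} u∉N v∉N u~v with outer-edge u∉N v∉N u~v
    ... | inj₁ (i′ , j , i↑≡i′↑ , v≡j↑ , i′~j) with ↑ˡ-injective b i i′ i↑≡i′↑
    ...   | refl = j , v≡j↑ , i′~j
    reflects {i} u∉N v∉N u~v | inj₂ (i′ , _ , i↑≡a↑i′ , _) = ⊥-elim (↑ˡ≢↑ʳ i i′ i↑≡a↑i′)

  right-embedding : Embedding B DB G (DA ++ DB)
  right-embedding = record
    { ι = a ↑ʳ_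
    ; ι-injective = ↑ʳ-injective a _ _
    ; ι-preserves-N = λ {j} j∈N → core⊆N (inj₂ (j , refl , j∈N))
    ; ι-reflects-outer-edges = reflects
    }
    where
    reflects : ∀ {i v} → ¬ (a ↑ʳ i) ∈N[ G ] (DA ++ DB) → ¬ v ∈N[ G ] (DA ++ DB) →
               Adj G (a ↑ʳ i) v → ∃[ j ] (v ≡ a ↑ʳ j × Adj B i j)
    reflects {i} u∉N v∉N u~v with outer-edge u∉N v∉N u~v
    ... | inj₂ (i′ , j , a↑i≡a↑i′ , v≡a↑j , i′~j) with ↑ʳ-injective a i i′ a↑i≡a↑i′
    ...   | refl = j , v≡a↑j , i′~j
    reflects {i} u∉N v∉N u~v | inj₁ (i′ , _ , a↑i≡i′↑ , _) = ⊥-elim (↑ˡ≢↑ʳ i′ i (sym a↑i≡i′↑))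

  glued-isolating : ∀ {k} {F : Graph k} → Connected F →
                    Isolating A F DA → Isolating B F DB → Isolating G F (DA ++ DB)
  glued-isolating {zero}  {F} _           A-iso _     _ = A-iso (empty-copy F A DA)
  glued-isolating {suc k} {F} F-connected A-iso B-iso c with ↑ˡ-or-↑ʳ (CopyAvoiding.f c zero)
  ... | inj₁ (_ , f0≡i↑) = A-iso (pullback F-connected left-embedding  c zero f0≡i↑)
  ... | inj₂ (_ , f0≡a↑j) = B-iso (pullback F-connected right-embedding c zero f0≡a↑j)

lemma3p3 : ∀ {k a b} (F : Graph k) → Connected F →
    (A : Graph a) (B : Graph b) (DA : Subset a) (DB : Subset b) →
    MinIsolating A F DA → MinIsolating B F DB →
    (G : Graph (a + b)) → Glued A DA B DB G →
    ∀ ιG → IsIota G F ιG → ιG ≤ ∣ DA ∣ + ∣ DB ∣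
lemma3p3 F F-connected A B DA DB (A-iso , _) (B-iso , _) G glued ιG (DG , (_ , DG-minimum) , ∣DG∣≡ιG) =
  subst (_≤ ∣ DA ∣ + ∣ DB ∣) ∣DG∣≡ιG
    (≤-trans (DG-minimum (DA ++ DB) (glued-isolating glued F-connected A-iso B-iso))
             (≤-reflexive (∣p++q∣≡∣p∣+∣q∣ DA DB)))
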